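{- Let $\mathfrak{s}=(s_1,\dots,s_r)\in\mathbb{N}^r$ and $\mathbf{u}=(u_1,\dots,u_r)\in(\overline{k}^\times)^r$, and let $G_{\mathfrak{s},\mathbf{u}}$ be the $t$-module described in the context, with logarithm $\log_{G_{\mathfrak{s},\mathbf{u}}}=\sum_{i\ge0}P_i\tau^i$, $P_0=I_d$. For each $i\ge0$ write the $d_1$-th row of $P_i$ as $(Y_1^{<i>},\dots,Y_r^{<i>})$ with $Y_m^{<i>}=(y^{<i>}_{m,1},\dots,y^{<i>}_{m,d_m})\in\overline{k}^{d_m}$. Then for $1\le j\le d_1$, $$y^{<i>}_{1,j}=\frac{(-[i])^{d_1-j}}{L_i^{d_1}},$$ and for $2\le m\le r$ and $1\le j\le d_m$, $$y^{<i>}_{m,j}=(-1)^{m-1}(-[i])^{d_m-j}\sum_{0\le i_1\le\cdots\le i_{m-1}<i}\frac{u_1^{q^{i_1}}\cdots u_{m-1}^{q^{i_{m-1}}}}{L_{i_1}^{s_1}\cdots L_{i_{m-1}}^{s_{m-1}}L_i^{d_m}}.$$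
   Context: $q$ is a prime power, $A=\mathbb{F}_q[\theta]$, $k=\mathbb{F}_q(\theta)$, $\overline{k}$ an algebraic closure. $[i]:=\theta^{q^i}-\theta$ for $i\ge0$ (so $[0]=0$, and $0^0:=1$), $L_0:=1$, $L_i:=(-1)^i[i][i-1]\cdots[1]$ for $i\ge1$. Let $\tau$ denote the $q$-th power Frobenius, and $\overline{k}[\tau]$ the twisted polynomial ring with $\tau\alpha=\alpha^q\tau$; matrices $M\in\mathrm{Mat}_d(\overline{k}[\tau])$ act on column vectors $x$ via $\tau x=x^{(1)}$ (entrywise $q$-th power), and $\partial(\sum_i M_i\tau^i):=M_0$. The $t$-module $G_{\mathfrak{s},\mathbf{u}}$: put $d_\ell:=s_\ell+\dots+s_r$ ($1\le\ell\le r$), $d:=d_1+\dots+d_r$. Let $N_\ell\in\mathrm{Mat}_{d_\ell}$ be the nilpotent matrix with $1$'s on the superdiagonal and $0$ elsewhere, and $N:=\mathrm{diag}(N_1,\dots,N_r)\in\mathrm{Mat}_d(\overline{k})$. Let $E\in\mathrm{Mat}_d(\overline{k})$ be the block matrix with blocks $E[\ell m]\in\mathrm{Mat}_{d_\ell\times d_m}(\overline{k})$, where $E[\ell m]=0$ for $\ell>m$, and for $\ell\le m$ the only possibly nonzero entry of $E[\ell m]$ is in its bottom-left corner (row $d_\ell$, column $1$), equal to $1$ if $\ell=m$ and to $(-1)^{m-\ell}\prod_{e=\ell}^{m-1}u_e$ if $\ell<m$. Then $G_{\mathfrak{s},\mathbf{u}}=(\mathbb{G}_a^d,\rho)$ where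 $\rho:\mathbb{F}_q[t]\to\mathrm{Mat}_d(\overline{k}[\tau])$ is the $\mathbb{F}_q$-algebra homomorphism with $\rho_t=\theta I_d+N+E\tau$. Its logarithm $\log_{G_{\mathfrak{s},\mathbf{u}}}=\sum_{i\ge0}P_i\tau^i$ ($P_i\in\mathrm{Mat}_d(\overline{k})$, $P_0=I_d$) is the unique such formal series with $\log_{G_{\mathfrak{s},\mathbf{u}}}\circ\rho_t=\partial\rho_t\circ\log_{G_{\mathfrak{s},\mathbf{u}}}$. -}

module Defs where

open import Level using (Level; _⊔_) renaming (suc to lsuc)
open import Algebra.Bundles using (CommutativeRing)
open import Data.Nat as ℕ using (ℕ; zero; suc; _∸_; _^_; _≤?_; _<?_)
open import Data.Nat.Primality using (Prime)
open import Data.Fin as Fin using (Fin; toℕ; inject₁; fromℕ; inject)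
open import Data.Product using (Σ; ∃; _×_; _,_)
open import Data.List using (List; []; _∷_; _++_; [_])
open import Data.List.Relation.Unary.All using (All)
open import Data.List.Relation.Unary.Any using (Any)
open import Data.Bool using (Bool; if_then_else_; _∧_)
open import Relation.Nullary using (¬_)
open import Relation.Nullary.Decidable using (⌊_⌋)
open import Relation.Binary.PropositionalEquality using (_≡_)

-- A field: a commutative ring with 0 ≠ 1 and an inverse for every nonzero element
-- (the value of _⁻¹ at 0 is irrelevant).
record Field (c ℓ : Level) : Set (lsuc (c ⊔ ℓ)) where
  field
    commRing : CommutativeRing c ℓ
  open CommutativeRing commRing public
  field
    _⁻¹      : Carrier → Carrier
    0≉1      : ¬ (0# ≈ 1#)
    inverseʳ : ∀ x → ¬ (x ≈ 0#) → (x * (x ⁻¹)) ≈ 1#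

module Setup {c ℓ} (F : Field c ℓ) where
  open Field F hiding (zero)

  pow : Carrier → ℕ → Carrier
  pow x zero    = 1#
  pow x (suc n) = x * pow x n

  natK : ℕ → Carrier
  natK zero    = 0#
  natK (suc n) = 1# + natK n

  -- polynomials as coefficient lists (constant term first), Horner evaluation
  evalP : List Carrier → Carrier → Carrier
  evalP []       x = 0#
  evalP (a ∷ as) x = a + x * evalP as x

  NonZeroPoly : List Carrier → Set (c ⊔ ℓ)
  NonZeroPoly as = Any (λ a → ¬ (a ≈ 0#)) as

  ∑< : ℕ → (ℕ → Carrier) → Carrier
  ∑< zero    f = 0#
  ∑< (suc n) f = ∑< n f + f n

  ∑Fin : ∀ {n} → (Fin n → Carrier) → Carrier
  ∑Fin {zero}  f = 0#
  ∑Fin {suc n} f = f Fin.zero + ∑Fin (λ i → f (Fin.suc i))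

  ∏Fin : ∀ {n} → (Fin n → Carrier) → Carrier
  ∏Fin {zero}  f = 1#
  ∏Fin {suc n} f = f Fin.zero * ∏Fin (λ i → f (Fin.suc i))

  ∑ℕFin : ∀ {n} → (Fin n → ℕ) → ℕ
  ∑ℕFin {zero}  f = 0
  ∑ℕFin {suc n} f = f Fin.zero ℕ.+ ∑ℕFin (λ i → f (Fin.suc i))

  -- The ground field situation: F is an algebraic closure of k = F_q(θ),
  -- where q = p^e, p = char F prime, e ≥ 1, θ transcendental over F_q.
  module Ground (q : ℕ) (θ : Carrier) where

    -- elements of F_q ⊂ F (the roots of X^q - X)
    IsFq : Carrier → Set ℓ
    IsFq a = pow a q ≈ a

    InA : Carrier → Set (c ⊔ ℓ)
    InA a = ∃ λ (cs : List Carrier) → All IsFq cs × (a ≈ evalP cs θ)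

    record IsAlgClosureOfFqθ (p e : ℕ) : Set (c ⊔ ℓ) where
      field
        p-prime     : Prime p
        char-p      : natK p ≈ 0#
        e≥1         : 1 ℕ.≤ e
        q≡p^e       : q ≡ p ^ e
        θ-transc    : ∀ (cs : List Carrier) → All IsFq cs → NonZeroPoly cs → ¬ (evalP cs θ ≈ 0#)
        -- F is algebraically closed: every monic polynomial of degree ≥ 1 has a root
        alg-closed  : ∀ (a : Carrier) (as : List Carrier) → ∃ λ x → evalP ((a ∷ as) ++ [ 1# ]) x ≈ 0#
        -- F is algebraic over k = F_q(θ) (equivalently, over A = F_q[θ])
        algebraic   : ∀ (x : Carrier) → ∃ λ (cs : List Carrier) → All InA cs × NonZeroPoly cs × (evalP cs x ≈ 0#)

    br : ℕ → Carrier
    br i = pow θ (q ^ i) - θ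

    brProd : ℕ → Carrier
    brProd zero    = 1#
    brProd (suc i) = br (suc i) * brProd i

    L : ℕ → Carrier
    L i = pow (- 1#) i * brProd i

    -- The t-module G_{s,u}.  Indices ℓ : Fin r are 0-based (ℓ ↔ paper's ℓ+1).
    module TModule {r : ℕ} (s : Fin r → ℕ) (u : Fin r → Carrier) where

      dd : Fin r → ℕ
      dd ℓ' = ∑ℕFin (λ m → if ⌊ toℕ ℓ' ≤? toℕ m ⌋ then s m else 0)

      -- index set of 𝔾_a^d, d = d_1 + ⋯ + d_r, organised in blocks
      Idx : Set
      Idx = Σ (Fin r) (λ ℓ' → Fin (dd ℓ'))

      Mat : Set c
      Mat = Idx → Idx → Carrier

      ∑Idx : (Idx → Carrier) → Carrier
      ∑Idx f = ∑Fin (λ ℓ' → ∑Fin (λ a → f (ℓ' , a)))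

      _·M_ : Mat → Mat → Mat
      (A ·M B) x y = ∑Idx (λ z → A x z * B z y)

      _+M_ : Mat → Mat → Mat
      (A +M B) x y = A x y + B x y

      _·s_ : Carrier → Mat → Mat
      (a ·s B) x y = a * B x y

      -- entrywise q^k-th power (twist by τ^k)
      frobM : ℕ → Mat → Mat
      frobM k A x y = pow (A x y) (q ^ k)

      0M : Mat
      0M x y = 0#

      IdM : Mat
      IdM (ℓ' , a) (m , b) =
        if ⌊ toℕ ℓ' ℕ.≟ toℕ m ⌋ ∧ ⌊ toℕ a ℕ.≟ toℕ b ⌋ then 1# else 0#

      NM : Mat
      NM (ℓ' , a) (m , b) =
        if ⌊ toℕ ℓ' ℕ.≟ toℕ m ⌋ ∧ ⌊ suc (toℕ a) ℕ.≟ toℕ b ⌋ then 1# else 0#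

      Ecoef : Fin r → Fin r → Carrier
      Ecoef ℓ' m = pow (- 1#) (toℕ m ∸ toℕ ℓ')
                   * ∏Fin (λ e → if ⌊ toℕ ℓ' ≤? toℕ e ⌋ ∧ ⌊ toℕ e <? toℕ m ⌋ then u e else 1#)

      EM : Mat
      EM (ℓ' , a) (m , b) =
        if ⌊ toℕ ℓ' ≤? toℕ m ⌋ ∧ ⌊ suc (toℕ a) ℕ.≟ dd ℓ' ⌋ ∧ ⌊ toℕ b ℕ.≟ 0 ⌋
        then Ecoef ℓ' m else 0#

      -- formal series ∑_i M_i τ^i in Mat_d(F)[[τ]]
      Series : Set c
      Series = ℕ → Mat

      -- product in the twisted ring: (∑ f_a τ^a)(∑ g_b τ^b) = ∑_n (∑_{a+b=n} f_a g_b^{(a)}) τ^n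
      _⊛_ : Series → Series → Series
      (f ⊛ g) n x y = ∑< (suc n) (λ a → (f a ·M frobM a (g (n ∸ a))) x y)

      _≈S_ : Series → Series → Set ℓ
      f ≈S g = ∀ n x y → f n x y ≈ g n x y

      ρt : Series
      ρt zero          = (θ ·s IdM) +M NM
      ρt (suc zero)    = EM
      ρt (suc (suc _)) = 0M

      ∂ρt : Series
      ∂ρt zero    = (θ ·s IdM) +M NM
      ∂ρt (suc _) = 0M

      IsLog : Series → Set ℓ
      IsLog P = (∀ x y → P zero x y ≈ IdM x y) × ((P ⊛ ρt) ≈S (∂ρt ⊛ P))

    -- ∑_{0 ≤ i_1 ≤ ⋯ ≤ i_k < i} w_1(i_1) ⋯ w_k(i_k), written as an iterated sum
    -- (outermost over the last index i_k < i; then i_{k-1} ≤ i_k, i.e. i_{k-1} < i_k + 1, …).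
    -- Weights are indexed 0-based: w e ↔ paper's w_{e+1}.
    chainSum : (k : ℕ) → (Fin k → ℕ → Carrier) → ℕ → Carrier
    chainSum zero    w i = 1#
    chainSum (suc k) w i = ∑< i (λ j → chainSum k (λ e → w (inject₁ e)) (suc j) * w (fromℕ k) j)

-- Comparing the coefficients of τ^(k+1) in log ∘ ρ_t = ∂ρ_t ∘ log along the d₁-th row x₀ of P, on which N
-- vanishes, gives
--   [k+1] P_(k+1)[x₀, y] = -((P_k E^(q^k))[x₀, y] + (P_(k+1) N)[x₀, y]).
-- The second term shifts the row one column to the right inside each block; the first lives on the first
-- column of each block m and collects the last entries of the blocks ℓ ≤ m of row x₀ of P_k, weighted by
-- the corner entries of E. By induction on k, and for fixed k on the column, the closed form follows: the
-- corner entries satisfy E_(ℓ,m+1) = -u_m E_(ℓ,m), so the weighted sums telescope into the recursion of the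
-- chain sums, and L_(k+1) = -[k+1] L_k absorbs the factor [k+1]. The ground field enters only through
-- (-1)^q = -1 and [k] ≠ 0 for k ≥ 1, the latter because θ is transcendental over F_q.

{-# OPTIONS --safe #-}
module Submission where

open import Defs
open import Level using (Level)
open import Algebra.Bundles using (CommutativeMonoid)
import Algebra.Properties.CommutativeMonoid.Sum as CommutativeMonoidSum
import Algebra.Properties.CommutativeSemigroup as CommutativeSemigroupProperties
import Algebra.Properties.CommutativeSemiring.Exp as CommutativeSemiringExp
import Algebra.Properties.Ring as RingProperties
import Algebra.Properties.Semiring.Sum as SemiringSum
import Algebra.Solver.CommutativeMonoid as CommutativeMonoidSolver
open import Data.Bool using (if_then_else_; _∧_)
open import Data.Empty using (⊥-elim)
open import Data.Fin as Fin using (Fin; toℕ; inject; inject₁; fromℕ)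
import Data.Fin.Properties as Fin
open import Data.Fin.Induction using (<-weakInduction)
open import Data.List using (List; []; _∷_; _++_; [_]; replicate)
open import Data.List.Relation.Unary.All using (All; []; _∷_)
open import Data.List.Relation.Unary.Any using (here; there)
open import Data.Nat as ℕ using (ℕ; zero; suc; _≤_; _<_; _∸_; _^_; s≤s)
open import Data.Nat.Divisibility using (divides)
open import Data.Nat.Primality using (prime⇒irreducible; prime⇒nonTrivial)
import Data.Nat.Properties as ℕ
open import Data.Product using (∃; _×_; _,_; proj₁; proj₂)
open import Data.Sum using (_⊎_; inj₁; inj₂)
open import Function using (_∘_)
open import Relation.Nullary using (¬_; yes; no)
open import Relation.Nullary.Decidable using (⌊_⌋)
open import Relation.Binary.PropositionalEquality as ≡ using (_≡_; _≢_)

module _ {a ℓ : Level} (M : CommutativeMonoid a ℓ) where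
  open CommutativeMonoid M
  open CommutativeMonoidSum M using (sum; sum-cong-≋)
  open import Relation.Binary.Reasoning.Setoid setoid

  sum-isolate : ∀ {n} {f g : Fin n → Carrier} (j : Fin n) →
                (∀ i → i ≢ j → g i ≈ f i) → f j ≈ ε → sum g ≈ g j ∙ sum f
  sum-isolate {suc n} {f} {g} Fin.zero g≈f fj≈ε = begin
    g Fin.zero ∙ sum (g ∘ Fin.suc)        ≈⟨ ∙-congˡ (sum-cong-≋ (λ i → g≈f (Fin.suc i) λ ())) ⟩
    g Fin.zero ∙ sum (f ∘ Fin.suc)        ≈⟨ ∙-congˡ (identityˡ _) ⟨
    g Fin.zero ∙ (ε ∙ sum (f ∘ Fin.suc))  ≈⟨ ∙-congˡ (∙-congʳ fj≈ε) ⟨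
    g Fin.zero ∙ sum f                    ∎
  sum-isolate {suc n} {f} {g} (Fin.suc j) g≈f fj≈ε = begin
    g Fin.zero ∙ sum (g ∘ Fin.suc)
      ≈⟨ ∙-cong (g≈f Fin.zero λ ()) (sum-isolate j (λ i → g≈f (Fin.suc i) ∘ (_∘ Fin.suc-injective)) fj≈ε) ⟩
    f Fin.zero ∙ (g (Fin.suc j) ∙ sum (f ∘ Fin.suc))
      ≈⟨ solve 3 (λ x y z → x ⊕ (y ⊕ z) ⊜ y ⊕ (x ⊕ z)) refl (f Fin.zero) (g (Fin.suc j)) _ ⟩
    g (Fin.suc j) ∙ sum f
      ∎
    where open CommutativeMonoidSolver M using (solve; _⊜_; _⊕_)

module FieldLemmas {c ℓ : Level} (F : Field c ℓ) where
  open Field F hiding (zero)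
  open Setup F
  open RingProperties ring using (-‿involutive; -0#≈0#; -‿distribˡ-*; +-inverseʳ-unique)
  open CommutativeSemiringExp commutativeSemiring using (^-congˡ; ^-homo-*; ^-assocʳ; ^-distrib-*)
    renaming (_^_ to _^ᶠ_)
  open SemiringSum semiring using (sum; sum-cong-≋; sum-replicate-zero; ∑-distrib-+; *-distribˡ-sum)
  open import Relation.Binary.Reasoning.Setoid setoid

  pow≡^ : ∀ x n → pow x n ≡ x ^ᶠ n
  pow≡^ x zero    = ≡.refl
  pow≡^ x (suc n) = ≡.cong (x *_) (pow≡^ x n)

  pow-cong : ∀ n {x y} → x ≈ y → pow x n ≈ pow y n
  pow-cong n {x} {y} x≈y rewrite pow≡^ x n | pow≡^ y n = ^-congˡ n x≈y

  pow-homo-+ : ∀ x m n → pow x (m ℕ.+ n) ≈ pow x m * pow x n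
  pow-homo-+ x m n rewrite pow≡^ x (m ℕ.+ n) | pow≡^ x m | pow≡^ x n = ^-homo-* x m n

  pow-assoc : ∀ x m n → pow (pow x m) n ≈ pow x (m ℕ.* n)
  pow-assoc x m n rewrite pow≡^ (pow x m) n | pow≡^ x m | pow≡^ x (m ℕ.* n) = ^-assocʳ x m n

  pow-distrib-* : ∀ x y n → pow (x * y) n ≈ pow x n * pow y n
  pow-distrib-* x y n rewrite pow≡^ (x * y) n | pow≡^ x n | pow≡^ y n = ^-distrib-* x y n

  pow-1# : ∀ n → pow 1# n ≈ 1#
  pow-1# zero    = refl
  pow-1# (suc n) = trans (*-identityˡ _) (pow-1# n)

  pow-≈0 : ∀ {x} n → x ≈ 0# → 0 < n → pow x n ≈ 0#
  pow-≈0 (suc n) x≈0 _ = trans (*-congʳ x≈0) (zeroˡ _)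

  x⁻¹*x≈1 : ∀ {x} → ¬ x ≈ 0# → x ⁻¹ * x ≈ 1#
  x⁻¹*x≈1 x≉0 = trans (*-comm _ _) (inverseʳ _ x≉0)

  *-cancelˡ : ∀ {z x y} → ¬ z ≈ 0# → z * x ≈ z * y → x ≈ y
  *-cancelˡ {z} {x} {y} z≉0 zx≈zy = begin
    x                ≈⟨ *-identityˡ x ⟨
    1# * x           ≈⟨ *-congʳ (x⁻¹*x≈1 z≉0) ⟨
    (z ⁻¹ * z) * x   ≈⟨ *-assoc _ _ _ ⟩
    z ⁻¹ * (z * x)   ≈⟨ *-congˡ zx≈zy ⟩
    z ⁻¹ * (z * y)   ≈⟨ *-assoc _ _ _ ⟨
    (z ⁻¹ * z) * y   ≈⟨ *-congʳ (x⁻¹*x≈1 z≉0) ⟩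
    1# * y           ≈⟨ *-identityˡ y ⟩
    y                ∎

  *-≉0 : ∀ {x y} → ¬ x ≈ 0# → ¬ y ≈ 0# → ¬ x * y ≈ 0#
  *-≉0 {x} {y} x≉0 y≉0 xy≈0 = y≉0 (*-cancelˡ x≉0 (trans xy≈0 (sym (zeroʳ x))))

  pow-≉0 : ∀ {x} n → ¬ x ≈ 0# → ¬ pow x n ≈ 0#
  pow-≉0 zero    x≉0 1≈0 = 0≉1 (sym 1≈0)
  pow-≉0 (suc n) x≉0     = *-≉0 x≉0 (pow-≉0 n x≉0)

  -1^m≈-1⇒-1^[m^n]≈-1 : ∀ {m} → pow (- 1#) m ≈ - 1# → ∀ n → pow (- 1#) (m ^ n) ≈ - 1#
  -1^m≈-1⇒-1^[m^n]≈-1 {m} -1^m≈-1 zero    = *-identityʳ _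
  -1^m≈-1⇒-1^[m^n]≈-1 {m} -1^m≈-1 (suc n) = begin
    pow (- 1#) (m ℕ.* m ^ n)    ≈⟨ pow-assoc (- 1#) m (m ^ n) ⟨
    pow (pow (- 1#) m) (m ^ n)  ≈⟨ pow-cong (m ^ n) -1^m≈-1 ⟩
    pow (- 1#) (m ^ n)          ≈⟨ -1^m≈-1⇒-1^[m^n]≈-1 -1^m≈-1 n ⟩
    - 1#                        ∎

  -1≉0 : ¬ - 1# ≈ 0#
  -1≉0 -1≈0 = 0≉1 (sym (trans (sym (-‿involutive 1#)) (trans (-‿cong -1≈0) -0#≈0#)))

  ∑Fin≡sum : ∀ {n} (f : Fin n → Carrier) → ∑Fin f ≡ sum f
  ∑Fin≡sum {zero}  f = ≡.refl
  ∑Fin≡sum {suc n} f = ≡.cong (f Fin.zero +_) (∑Fin≡sum (f ∘ Fin.suc))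

  ∏Fin≡product : ∀ {n} (f : Fin n → Carrier) → ∏Fin f ≡ CommutativeMonoidSum.sum *-commutativeMonoid f
  ∏Fin≡product {zero}  f = ≡.refl
  ∏Fin≡product {suc n} f = ≡.cong (f Fin.zero *_) (∏Fin≡product (f ∘ Fin.suc))

  ∑Fin-cong : ∀ {n} {f g : Fin n → Carrier} → (∀ i → f i ≈ g i) → ∑Fin f ≈ ∑Fin g
  ∑Fin-cong {f = f} {g} f≈g rewrite ∑Fin≡sum f | ∑Fin≡sum g = sum-cong-≋ f≈g

  ∑Fin-zero : ∀ {n} {f : Fin n → Carrier} → (∀ i → f i ≈ 0#) → ∑Fin f ≈ 0#
  ∑Fin-zero {n} {f} f≈0 rewrite ∑Fin≡sum f = trans (sum-cong-≋ f≈0) (sum-replicate-zero n)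

  ∑Fin-isolate : ∀ {n} {f g : Fin n → Carrier} (j : Fin n) →
                 (∀ i → i ≢ j → g i ≈ f i) → f j ≈ 0# → ∑Fin g ≈ g j + ∑Fin f
  ∑Fin-isolate {f = f} {g} j g≈f fj≈0 rewrite ∑Fin≡sum f | ∑Fin≡sum g = sum-isolate +-commutativeMonoid j g≈f fj≈0

  ∑Fin-single : ∀ {n} {f : Fin n → Carrier} (j : Fin n) → (∀ i → i ≢ j → f i ≈ 0#) → ∑Fin f ≈ f j
  ∑Fin-single {n} {f} j f≈0 = begin
    ∑Fin f                    ≈⟨ ∑Fin-isolate j f≈0 refl ⟩
    f j + ∑Fin {n} (λ _ → 0#) ≈⟨ +-congˡ (∑Fin-zero {n} (λ _ → refl)) ⟩
    f j + 0#                  ≈⟨ +-identityʳ _ ⟩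
    f j                       ∎

  ∑Fin-+ : ∀ {n} (f g : Fin n → Carrier) → ∑Fin (λ i → f i + g i) ≈ ∑Fin f + ∑Fin g
  ∑Fin-+ f g rewrite ∑Fin≡sum (λ i → f i + g i) | ∑Fin≡sum f | ∑Fin≡sum g = ∑-distrib-+ f g

  ∑Fin-*ˡ : ∀ {n} x (f : Fin n → Carrier) → ∑Fin (λ i → x * f i) ≈ x * ∑Fin f
  ∑Fin-*ˡ x f rewrite ∑Fin≡sum (λ i → x * f i) | ∑Fin≡sum f = sym (*-distribˡ-sum x f)

  ∏Fin-one : ∀ {n} {f : Fin n → Carrier} → (∀ i → f i ≈ 1#) → ∏Fin f ≈ 1#
  ∏Fin-one {n} {f} f≈1 rewrite ∏Fin≡product f = trans (Product.sum-cong-≋ f≈1) (Product.sum-replicate-zero n)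
    where module Product = CommutativeMonoidSum *-commutativeMonoid

  ∏Fin-isolate : ∀ {n} {f g : Fin n → Carrier} (j : Fin n) →
                 (∀ i → i ≢ j → g i ≈ f i) → f j ≈ 1# → ∏Fin g ≈ g j * ∏Fin f
  ∏Fin-isolate {f = f} {g} j g≈f fj≈1 rewrite ∏Fin≡product f | ∏Fin≡product g =
    sum-isolate *-commutativeMonoid j g≈f fj≈1

  ∑ℕFin≡sum : ∀ {n} (f : Fin n → ℕ) → ∑ℕFin f ≡ CommutativeMonoidSum.sum ℕ.+-0-commutativeMonoid f
  ∑ℕFin≡sum {zero}  f = ≡.refl
  ∑ℕFin≡sum {suc n} f = ≡.cong (f Fin.zero ℕ.+_) (∑ℕFin≡sum (f ∘ Fin.suc))

  ∑<-cong : ∀ n {f g : ℕ → Carrier} → (∀ j → f j ≈ g j) → ∑< n f ≈ ∑< n g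
  ∑<-cong zero    f≈g = refl
  ∑<-cong (suc n) f≈g = +-cong (∑<-cong n f≈g) (f≈g n)

  ∑<-zero : ∀ n {f : ℕ → Carrier} → (∀ j → j < n → f j ≈ 0#) → ∑< n f ≈ 0#
  ∑<-zero zero    f≈0 = refl
  ∑<-zero (suc n) f≈0 =
    trans (+-cong (∑<-zero n (λ j j<n → f≈0 j (ℕ.m<n⇒m<1+n j<n))) (f≈0 n ℕ.≤-refl)) (+-identityˡ 0#)

  ∑<-first : ∀ n {f : ℕ → Carrier} → (∀ j → f (suc j) ≈ 0#) → ∑< (suc n) f ≈ f 0
  ∑<-first zero    f≈0 = +-identityˡ _
  ∑<-first (suc n) f≈0 = trans (+-cong (∑<-first n f≈0) (f≈0 n)) (+-identityʳ _)

  x*y≈-[-x*y] : ∀ x y → x * y ≈ - (- x * y)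
  x*y≈-[-x*y] x y = trans (sym (-‿involutive _)) (-‿cong (-‿distribˡ-* x y))

  x+[a*p+y]≈b*p⇒[a-b]*p≈-[x+y] : ∀ {x y a b p} → x + (a * p + y) ≈ b * p → (a - b) * p ≈ - (x + y)
  x+[a*p+y]≈b*p⇒[a-b]*p≈-[x+y] {x} {y} {a} {b} {p} eq = +-inverseʳ-unique (x + y) _ (begin
    (x + y) + (a - b) * p
      ≈⟨ +-congˡ (distribʳ p a (- b)) ⟩
    (x + y) + (a * p + - b * p)
      ≈⟨ solve 4 (λ x y ap bp → (x ⊕ y) ⊕ (ap ⊕ bp) ⊜ (x ⊕ (ap ⊕ y)) ⊕ bp) refl x y (a * p) (- b * p) ⟩
    (x + (a * p + y)) + - b * p
      ≈⟨ +-cong eq (sym (-‿distribˡ-* b p)) ⟩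
    b * p + - (b * p)
      ≈⟨ -‿inverseʳ (b * p) ⟩
    0#
      ∎)
    where open CommutativeMonoidSolver +-commutativeMonoid using (solve; _⊜_; _⊕_)

module TModuleLemmas {c ℓ : Level} (F : Field c ℓ) (q : ℕ) (θ : Field.Carrier F) (q>0 : 0 < q)
                     {r : ℕ} (s : Fin r → ℕ) (u : Fin r → Field.Carrier F) where
  open Field F hiding (zero)
  open Setup F
  open Ground q θ
  open TModule s u
  open FieldLemmas F
  open CommutativeSemigroupProperties *-commutativeSemigroup using (x∙yz≈y∙xz)
  open import Relation.Binary.Reasoning.Setoid setoid

  q^n>0 : ∀ n → 0 < q ^ n
  q^n>0 = ℕ.m^n>0 q {{ℕ.>-nonZero q>0}}

  ∑Idx-cong : ∀ {f g : Idx → Carrier} → (∀ z → f z ≈ g z) → ∑Idx f ≈ ∑Idx g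
  ∑Idx-cong f≈g = ∑Fin-cong (λ ℓ → ∑Fin-cong (λ b → f≈g (ℓ , b)))

  ∑Idx-zero : ∀ {f : Idx → Carrier} → (∀ z → f z ≈ 0#) → ∑Idx f ≈ 0#
  ∑Idx-zero f≈0 = ∑Fin-zero (λ ℓ → ∑Fin-zero (λ b → f≈0 (ℓ , b)))

  ∑Idx-*ˡ : ∀ x (f : Idx → Carrier) → ∑Idx (λ z → x * f z) ≈ x * ∑Idx f
  ∑Idx-*ˡ x f = trans (∑Fin-cong (λ ℓ → ∑Fin-*ˡ x (λ b → f (ℓ , b))))
                      (∑Fin-*ˡ x (λ ℓ → ∑Fin (λ b → f (ℓ , b))))

  ∑Idx-+ : ∀ (f g : Idx → Carrier) → ∑Idx (λ z → f z + g z) ≈ ∑Idx f + ∑Idx g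
  ∑Idx-+ f g = trans (∑Fin-cong (λ ℓ → ∑Fin-+ (λ b → f (ℓ , b)) (λ b → g (ℓ , b))))
                     (∑Fin-+ (λ ℓ → ∑Fin (λ b → f (ℓ , b))) (λ ℓ → ∑Fin (λ b → g (ℓ , b))))

  ∑Idx-single : ∀ {f : Idx → Carrier} ℓ₀ (b₀ : Fin (dd ℓ₀)) →
                (∀ ℓ b → ℓ ≢ ℓ₀ → f (ℓ , b) ≈ 0#) → (∀ b → b ≢ b₀ → f (ℓ₀ , b) ≈ 0#) →
                ∑Idx f ≈ f (ℓ₀ , b₀)
  ∑Idx-single ℓ₀ b₀ off-block off-entry =
    trans (∑Fin-single ℓ₀ (λ ℓ ℓ≢ℓ₀ → ∑Fin-zero (λ b → off-block ℓ b ℓ≢ℓ₀)))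
          (∑Fin-single b₀ off-entry)

  ∑Idx-lastRows : ∀ {f : Idx → Carrier} (last : ∀ ℓ → Fin (dd ℓ)) → (∀ ℓ → suc (toℕ (last ℓ)) ≡ dd ℓ) →
                  (∀ ℓ b → suc (toℕ b) ≢ dd ℓ → f (ℓ , b) ≈ 0#) →
                  ∑Idx f ≈ ∑Fin (λ ℓ → f (ℓ , last ℓ))
  ∑Idx-lastRows last last-is-last f≈0 = ∑Fin-cong (λ ℓ → ∑Fin-single (last ℓ) (λ b b≢last → f≈0 ℓ b (λ b-last →
    b≢last (Fin.toℕ-injective (ℕ.suc-injective (≡.trans b-last (≡.sym (last-is-last ℓ))))))))

  IdM-diag : ∀ x → IdM x x ≈ 1#
  IdM-diag (ℓ , a) with toℕ ℓ ℕ.≟ toℕ ℓ | toℕ a ℕ.≟ toℕ a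
  ... | yes _   | yes _   = refl
  ... | no ℓ≢ℓ  | _       = ⊥-elim (ℓ≢ℓ ≡.refl)
  ... | yes _   | no a≢a  = ⊥-elim (a≢a ≡.refl)

  IdM-offBlock : ∀ {ℓ m} (a : Fin (dd ℓ)) (b : Fin (dd m)) → ℓ ≢ m → IdM (ℓ , a) (m , b) ≡ 0#
  IdM-offBlock {ℓ} {m} a b ℓ≢m with toℕ ℓ ℕ.≟ toℕ m
  ... | yes ℓ≡m = ⊥-elim (ℓ≢m (Fin.toℕ-injective ℓ≡m))
  ... | no _    = ≡.refl

  IdM-offDiag : ∀ {ℓ} (a b : Fin (dd ℓ)) → a ≢ b → IdM (ℓ , a) (ℓ , b) ≡ 0#
  IdM-offDiag {ℓ} a b a≢b with toℕ ℓ ℕ.≟ toℕ ℓ | toℕ a ℕ.≟ toℕ b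
  ... | no _    | _       = ≡.refl
  ... | yes _   | no _    = ≡.refl
  ... | yes _   | yes a≡b = ⊥-elim (a≢b (Fin.toℕ-injective a≡b))

  NM-lastRow : ∀ {ℓ} (a : Fin (dd ℓ)) y → suc (toℕ a) ≡ dd ℓ → NM (ℓ , a) y ≡ 0#
  NM-lastRow {ℓ} a (m , b) a-is-last with toℕ ℓ ℕ.≟ toℕ m | suc (toℕ a) ℕ.≟ toℕ b
  ... | no _    | _       = ≡.refl
  ... | yes _   | no _    = ≡.refl
  ... | yes ℓ≡m | yes a+1≡b with Fin.toℕ-injective ℓ≡m
  ...   | ≡.refl = ⊥-elim (ℕ.<-irrefl (≡.trans (≡.sym a+1≡b) a-is-last) (Fin.toℕ<n b))

  NM-firstCol : ∀ x {m} (c : Fin (dd m)) → toℕ c ≡ 0 → NM x (m , c) ≡ 0#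
  NM-firstCol (ℓ , b) {m} c c≡0 with toℕ ℓ ℕ.≟ toℕ m | suc (toℕ b) ℕ.≟ toℕ c
  ... | no _    | _       = ≡.refl
  ... | yes _   | no _    = ≡.refl
  ... | yes _   | yes b+1≡c = ⊥-elim (ℕ.0≢1+n (≡.sym (≡.trans b+1≡c c≡0)))

  NM-offBlock : ∀ {ℓ m} (b : Fin (dd ℓ)) (c : Fin (dd m)) → ℓ ≢ m → NM (ℓ , b) (m , c) ≡ 0#
  NM-offBlock {ℓ} {m} b c ℓ≢m with toℕ ℓ ℕ.≟ toℕ m
  ... | yes ℓ≡m = ⊥-elim (ℓ≢m (Fin.toℕ-injective ℓ≡m))
  ... | no _    = ≡.refl

  NM-superdiag : ∀ {m} (b c : Fin (dd m)) → toℕ c ≡ suc (toℕ b) → NM (m , b) (m , c) ≈ 1#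
  NM-superdiag {m} b c c≡b+1 with toℕ m ℕ.≟ toℕ m | suc (toℕ b) ℕ.≟ toℕ c
  ... | yes _   | yes _    = refl
  ... | no m≢m  | _        = ⊥-elim (m≢m ≡.refl)
  ... | yes _   | no b+1≢c = ⊥-elim (b+1≢c (≡.sym c≡b+1))

  NM-offSuperdiag : ∀ {m} (b c : Fin (dd m)) → toℕ c ≢ suc (toℕ b) → NM (m , b) (m , c) ≡ 0#
  NM-offSuperdiag {m} b c c≢b+1 with toℕ m ℕ.≟ toℕ m | suc (toℕ b) ℕ.≟ toℕ c
  ... | no _    | _        = ≡.refl
  ... | yes _   | no _     = ≡.refl
  ... | yes _   | yes b+1≡c = ⊥-elim (c≢b+1 (≡.sym b+1≡c))

  Ecorner : Fin r → Fin r → Carrier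
  Ecorner ℓ m = if ⌊ toℕ ℓ ℕ.≤? toℕ m ⌋ then Ecoef ℓ m else 0#

  EM-notFirstCol : ∀ x {m} (c : Fin (dd m)) → toℕ c ≢ 0 → EM x (m , c) ≡ 0#
  EM-notFirstCol (ℓ , b) {m} c c≢0 with toℕ ℓ ℕ.≤? toℕ m | suc (toℕ b) ℕ.≟ dd ℓ | toℕ c ℕ.≟ 0
  ... | no _  | _     | _       = ≡.refl
  ... | yes _ | no _  | _       = ≡.refl
  ... | yes _ | yes _ | no _    = ≡.refl
  ... | yes _ | yes _ | yes c≡0 = ⊥-elim (c≢0 c≡0)

  EM-notLastRow : ∀ {ℓ} (b : Fin (dd ℓ)) y → suc (toℕ b) ≢ dd ℓ → EM (ℓ , b) y ≡ 0#
  EM-notLastRow {ℓ} b (m , c) b≢last with toℕ ℓ ℕ.≤? toℕ m | suc (toℕ b) ℕ.≟ dd ℓ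
  ... | no _  | _          = ≡.refl
  ... | yes _ | no _       = ≡.refl
  ... | yes _ | yes b-last = ⊥-elim (b≢last b-last)

  EM-corner : ∀ {ℓ m} (b : Fin (dd ℓ)) (c : Fin (dd m)) → suc (toℕ b) ≡ dd ℓ → toℕ c ≡ 0 →
              EM (ℓ , b) (m , c) ≡ Ecorner ℓ m
  EM-corner {ℓ} {m} b c b-last c≡0 with toℕ ℓ ℕ.≤? toℕ m | suc (toℕ b) ℕ.≟ dd ℓ | toℕ c ℕ.≟ 0
  ... | no _  | _       | _        = ≡.refl
  ... | yes _ | yes _   | yes _    = ≡.refl
  ... | yes _ | no ¬last | _       = ⊥-elim (¬last b-last)
  ... | yes _ | yes _   | no c≢0   = ⊥-elim (c≢0 c≡0)

  ·M-identityʳ : ∀ A x y → (A ·M IdM) x y ≈ A x y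
  ·M-identityʳ A x (m , b) = begin
    ∑Idx (λ z → A x z * IdM z (m , b))  ≈⟨ ∑Idx-single m b off-block off-diag ⟩
    A x (m , b) * IdM (m , b) (m , b)   ≈⟨ *-congˡ (IdM-diag (m , b)) ⟩
    A x (m , b) * 1#                    ≈⟨ *-identityʳ _ ⟩
    A x (m , b)                         ∎
    where
    off-block : ∀ ℓ a → ℓ ≢ m → A x (ℓ , a) * IdM (ℓ , a) (m , b) ≈ 0#
    off-block ℓ a ℓ≢m = trans (*-congˡ (reflexive (IdM-offBlock a b ℓ≢m))) (zeroʳ _)
    off-diag : ∀ a → a ≢ b → A x (m , a) * IdM (m , a) (m , b) ≈ 0#
    off-diag a a≢b = trans (*-congˡ (reflexive (IdM-offDiag a b a≢b))) (zeroʳ _)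

  ·M-identityˡ : ∀ A x y → (IdM ·M A) x y ≈ A x y
  ·M-identityˡ A (ℓ , a) y = begin
    ∑Idx (λ z → IdM (ℓ , a) z * A z y)  ≈⟨ ∑Idx-single ℓ a off-block off-diag ⟩
    IdM (ℓ , a) (ℓ , a) * A (ℓ , a) y   ≈⟨ *-congʳ (IdM-diag (ℓ , a)) ⟩
    1# * A (ℓ , a) y                    ≈⟨ *-identityˡ _ ⟩
    A (ℓ , a) y                         ∎
    where
    off-block : ∀ m b → m ≢ ℓ → IdM (ℓ , a) (m , b) * A (m , b) y ≈ 0#
    off-block m b m≢ℓ = trans (*-congʳ (reflexive (IdM-offBlock a b (m≢ℓ ∘ ≡.sym)))) (zeroˡ _)
    off-diag : ∀ b → b ≢ a → IdM (ℓ , a) (ℓ , b) * A (ℓ , b) y ≈ 0#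
    off-diag b b≢a = trans (*-congʳ (reflexive (IdM-offDiag a b (b≢a ∘ ≡.sym)))) (zeroˡ _)

  ·M-NM-firstCol : ∀ A x {m} (c : Fin (dd m)) → toℕ c ≡ 0 → (A ·M NM) x (m , c) ≈ 0#
  ·M-NM-firstCol A x c c≡0 = ∑Idx-zero (λ z → trans (*-congˡ (reflexive (NM-firstCol z c c≡0))) (zeroʳ _))

  ·M-NM-shift : ∀ A x {m} (b c : Fin (dd m)) → toℕ c ≡ suc (toℕ b) → (A ·M NM) x (m , c) ≈ A x (m , b)
  ·M-NM-shift A x {m} b c c≡b+1 = begin
    ∑Idx (λ z → A x z * NM z (m , c))  ≈⟨ ∑Idx-single m b off-block off-superdiag ⟩
    A x (m , b) * NM (m , b) (m , c)   ≈⟨ *-congˡ (NM-superdiag b c c≡b+1) ⟩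
    A x (m , b) * 1#                   ≈⟨ *-identityʳ _ ⟩
    A x (m , b)                        ∎
    where
    off-block : ∀ ℓ a → ℓ ≢ m → A x (ℓ , a) * NM (ℓ , a) (m , c) ≈ 0#
    off-block ℓ a ℓ≢m = trans (*-congˡ (reflexive (NM-offBlock a c ℓ≢m))) (zeroʳ _)
    off-superdiag : ∀ a → a ≢ b → A x (m , a) * NM (m , a) (m , c) ≈ 0#
    off-superdiag a a≢b = trans (*-congˡ (reflexive (NM-offSuperdiag a c (λ c≡a+1 →
      a≢b (Fin.toℕ-injective (ℕ.suc-injective (≡.trans (≡.sym c≡a+1) c≡b+1))))))) (zeroʳ _)

  ·M-zeroʳ : ∀ A {B} x y → (∀ z → B z y ≈ 0#) → (A ·M B) x y ≈ 0#
  ·M-zeroʳ A x y B≈0 = ∑Idx-zero (λ z → trans (*-congˡ (B≈0 z)) (zeroʳ _))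

  frobM-0M : ∀ n x y → frobM n 0M x y ≈ 0#
  frobM-0M n x y = pow-≈0 (q ^ n) refl (q^n>0 n)

  -- Each entry of θI + N is θ, 1 or 0, so its q^n-th power is θ^(q^n), 1 or 0 respectively.
  frobM-ρt₀ : ∀ n x y → frobM n (ρt 0) x y ≈ pow θ (q ^ n) * IdM x y + NM x y
  frobM-ρt₀ n (ℓ , a) (m , b) with toℕ ℓ ℕ.≟ toℕ m | toℕ a ℕ.≟ toℕ b | suc (toℕ a) ℕ.≟ toℕ b
  ... | no _  | _       | _         =
    trans (pow-≈0 (q ^ n) (trans (+-identityʳ _) (zeroʳ θ)) (q^n>0 n)) (sym (trans (+-identityʳ _) (zeroʳ _)))
  ... | yes _ | yes a≡b | yes a+1≡b = ⊥-elim (ℕ.1+n≢n (≡.trans a+1≡b (≡.sym a≡b)))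
  ... | yes _ | yes _   | no _      =
    trans (pow-cong (q ^ n) (trans (+-identityʳ _) (*-identityʳ θ))) (sym (trans (+-identityʳ _) (*-identityʳ _)))
  ... | yes _ | no _    | yes _     =
    trans (pow-cong (q ^ n) (trans (+-congʳ (zeroʳ θ)) (+-identityˡ 1#)))
          (trans (pow-1# (q ^ n)) (sym (trans (+-congʳ (zeroʳ _)) (+-identityˡ 1#))))
  ... | yes _ | no _    | no _      =
    trans (pow-≈0 (q ^ n) (trans (+-identityʳ _) (zeroʳ θ)) (q^n>0 n)) (sym (trans (+-identityʳ _) (zeroʳ _)))

  ·M-frobM-ρt₀ : ∀ A n x y → (A ·M frobM n (ρt 0)) x y ≈ pow θ (q ^ n) * A x y + (A ·M NM) x y
  ·M-frobM-ρt₀ A n x y = begin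
    ∑Idx (λ z → A x z * frobM n (ρt 0) z y)
      ≈⟨ ∑Idx-cong (λ z → trans (*-congˡ (frobM-ρt₀ n z y))
                                (trans (distribˡ _ _ _) (+-congʳ (x∙yz≈y∙xz _ _ _)))) ⟩
    ∑Idx (λ z → θQ * (A x z * IdM z y) + A x z * NM z y)
      ≈⟨ ∑Idx-+ (λ z → θQ * (A x z * IdM z y)) (λ z → A x z * NM z y) ⟩
    ∑Idx (λ z → θQ * (A x z * IdM z y)) + (A ·M NM) x y
      ≈⟨ +-congʳ (trans (∑Idx-*ˡ θQ (λ z → A x z * IdM z y)) (*-congˡ (·M-identityʳ A x y))) ⟩
    θQ * A x y + (A ·M NM) x y
      ∎
    where
    θQ : Carrier
    θQ = pow θ (q ^ n)

  -- ρ_t has degree 1 in τ, so only P_k τ^k · Eτ and P_(k+1) τ^(k+1) · (θI + N) contribute.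
  ⊛ρt-suc : ∀ (P : Series) k x y →
            (P ⊛ ρt) (suc k) x y ≈ (P k ·M frobM k EM) x y + (pow θ (q ^ suc k) * P (suc k) x y + (P (suc k) ·M NM) x y)
  ⊛ρt-suc P k x y = +-cong (trans (+-congʳ (∑<-zero k high-degrees)) (trans (+-identityˡ _) degree-k)) degree-k+1
    where
    term : ℕ → Carrier
    term a = (P a ·M frobM a (ρt (suc k ∸ a))) x y
    high-degrees : ∀ a → a < k → term a ≈ 0#
    high-degrees a a<k = trans (reflexive (≡.cong (λ n → (P a ·M frobM a (ρt n)) x y) k+1∸a≡2+[k∸[1+a]]))
                               (·M-zeroʳ (P a) x y (λ z → frobM-0M a z y))
      where
      k+1∸a≡2+[k∸[1+a]] : suc k ∸ a ≡ suc (suc (k ∸ suc a))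
      k+1∸a≡2+[k∸[1+a]] = ≡.trans (ℕ.+-∸-assoc 1 (ℕ.<⇒≤ a<k)) (≡.cong suc (ℕ.+-∸-assoc 1 a<k))
    degree-k : term k ≈ (P k ·M frobM k EM) x y
    degree-k = reflexive (≡.cong (λ n → (P k ·M frobM k (ρt n)) x y) (ℕ.m+n∸n≡m 1 k))
    degree-k+1 : term (suc k) ≈ pow θ (q ^ suc k) * P (suc k) x y + (P (suc k) ·M NM) x y
    degree-k+1 = trans (reflexive (≡.cong (λ n → (P (suc k) ·M frobM (suc k) (ρt n)) x y) (ℕ.n∸n≡0 k)))
                       (·M-frobM-ρt₀ (P (suc k)) (suc k) x y)

  ∂ρt⊛-lastRow : ∀ (P : Series) n {ℓ} (a : Fin (dd ℓ)) y → suc (toℕ a) ≡ dd ℓ →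
                 (∂ρt ⊛ P) n (ℓ , a) y ≈ θ * P n (ℓ , a) y
  ∂ρt⊛-lastRow P n a y a-last = begin
    (∂ρt ⊛ P) n x y
      ≈⟨ ∑<-first n (λ j → ∑Idx-zero (λ z → zeroˡ _)) ⟩
    ∑Idx (λ z → (θ * IdM x z + NM x z) * pow (P n z y) 1)
      ≈⟨ ∑Idx-cong (λ z → trans (*-cong (trans (+-congˡ (reflexive (NM-lastRow a z a-last))) (+-identityʳ _))
                                        (*-identityʳ _))
                                (*-assoc _ _ _)) ⟩
    ∑Idx (λ z → θ * (IdM x z * P n z y))
      ≈⟨ trans (∑Idx-*ˡ θ (λ z → IdM x z * P n z y)) (*-congˡ (·M-identityˡ (P n) x y)) ⟩
    θ * P n x y
      ∎
    where
    x : Idx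
    x = (_ , a)

  log-lastRow-recursion : ∀ {P : Series} → (P ⊛ ρt) ≈S (∂ρt ⊛ P) →
    ∀ {ℓ} (a : Fin (dd ℓ)) → suc (toℕ a) ≡ dd ℓ → ∀ k y →
    br (suc k) * P (suc k) (ℓ , a) y ≈ - ((P k ·M frobM k EM) (ℓ , a) y + (P (suc k) ·M NM) (ℓ , a) y)
  log-lastRow-recursion {P} functional-eq a a-last k y = x+[a*p+y]≈b*p⇒[a-b]*p≈-[x+y] (begin
    (P k ·M frobM k EM) x y + (pow θ (q ^ suc k) * P (suc k) x y + (P (suc k) ·M NM) x y)
      ≈⟨ ⊛ρt-suc P k x y ⟨
    (P ⊛ ρt) (suc k) x y
      ≈⟨ functional-eq (suc k) x y ⟩
    (∂ρt ⊛ P) (suc k) x y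
      ≈⟨ ∂ρt⊛-lastRow P (suc k) a y a-last ⟩
    θ * P (suc k) x y
      ∎)
    where
    x : Idx
    x = (_ , a)

even⊎odd : ∀ n → ∃ λ k → n ≡ 2 ℕ.* k ⊎ n ≡ suc (2 ℕ.* k)
even⊎odd zero = 0 , inj₁ ≡.refl
even⊎odd (suc n) with even⊎odd n
... | k , inj₁ n≡2k   = k , inj₂ (≡.cong suc n≡2k)
... | k , inj₂ n≡2k+1 = suc k , inj₁ (≡.trans (≡.cong suc n≡2k+1) (≡.sym (ℕ.*-suc 2 k)))

module GroundLemmas {c ℓ : Level} (F : Field c ℓ) (q : ℕ) (θ : Field.Carrier F) where
  open Field F hiding (zero)
  open Setup F
  open Ground q θ
  open FieldLemmas F
  open RingProperties ring using (-‿involutive; -0#≈0#; -‿distribˡ-*; -1*x≈-x; +-inverseʳ-unique)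
  open CommutativeSemigroupProperties *-commutativeSemigroup using (interchange; x∙yz≈y∙xz)
  open import Relation.Binary.Reasoning.Setoid setoid

  chainSum-cong : ∀ {K K'} {v : Fin K → ℕ → Carrier} {w : Fin K' → ℕ → Carrier} → K ≡ K' →
                  (∀ e e' → toℕ e ≡ toℕ e' → ∀ j → v e j ≈ w e' j) → ∀ i → chainSum K v i ≈ chainSum K' w i
  chainSum-cong {zero}  ≡.refl v≈w i = refl
  chainSum-cong {suc K} ≡.refl v≈w i = ∑<-cong i (λ j → *-cong
    (chainSum-cong ≡.refl (λ e e' e≡e' → v≈w (inject₁ e) (inject₁ e') (toℕ-inject₁-cong e≡e')) (suc j))
    (v≈w (fromℕ K) (fromℕ K) ≡.refl j))
    where
    toℕ-inject₁-cong : ∀ {n} {e e' : Fin n} → toℕ e ≡ toℕ e' → toℕ (inject₁ e) ≡ toℕ (inject₁ e')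
    toℕ-inject₁-cong {e = e} {e'} e≡e' =
      ≡.trans (Fin.toℕ-inject₁ e) (≡.trans e≡e' (≡.sym (Fin.toℕ-inject₁ e')))

  module AlgClosureFacts {p e : ℕ} (AC : IsAlgClosureOfFqθ p e) where
    open IsAlgClosureOfFqθ AC

    1<q : 1 < q
    1<q rewrite q≡p^e = ℕ.^-monoʳ-< p (ℕ.nonTrivial⇒n>1 p {{prime⇒nonTrivial p-prime}}) e≥1

    q>0 : 0 < q
    q>0 = ℕ.<⇒≤ 1<q

    -1^p≈-1 : pow (- 1#) p ≈ - 1#
    -1^p≈-1 with even⊎odd p
    ... | k , inj₁ p≡2k = trans (pow-cong p (sym 1≈-1)) (trans (pow-1# p) 1≈-1)
      where
      p≡2 : p ≡ 2
      p≡2 with prime⇒irreducible p-prime (divides k (≡.trans p≡2k (ℕ.*-comm 2 k)))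
      ... | inj₁ ()
      ... | inj₂ 2≡p = ≡.sym 2≡p
      1≈-1 : 1# ≈ - 1#
      1≈-1 = +-inverseʳ-unique 1# 1#
        (trans (+-congˡ (sym (+-identityʳ 1#))) (trans (reflexive (≡.cong natK (≡.sym p≡2))) char-p))
    ... | k , inj₂ p≡2k+1 = begin
      pow (- 1#) p                 ≡⟨ ≡.cong (pow (- 1#)) p≡2k+1 ⟩
      - 1# * pow (- 1#) (2 ℕ.* k)  ≈⟨ *-congˡ (pow-assoc (- 1#) 2 k) ⟨
      - 1# * pow (pow (- 1#) 2) k  ≈⟨ *-congˡ (pow-cong k -1²≈1) ⟩
      - 1# * pow 1# k              ≈⟨ *-congˡ (pow-1# k) ⟩
      - 1# * 1#                    ≈⟨ *-identityʳ _ ⟩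
      - 1#                         ∎
      where
      -1²≈1 : pow (- 1#) 2 ≈ 1#
      -1²≈1 = trans (*-congˡ (*-identityʳ _)) (trans (-1*x≈-x _) (-‿involutive 1#))

    -1^q≈-1 : pow (- 1#) q ≈ - 1#
    -1^q≈-1 rewrite q≡p^e = -1^m≈-1⇒-1^[m^n]≈-1 -1^p≈-1 e

    monomial : ℕ → List Carrier
    monomial t = replicate t 0# ++ [ 1# ]

    evalP-monomial : ∀ t x → evalP (monomial t) x ≈ pow x t
    evalP-monomial zero    x = trans (+-congˡ (zeroʳ x)) (+-identityʳ 1#)
    evalP-monomial (suc t) x = trans (+-identityˡ _) (*-congˡ (evalP-monomial t x))

    monomial-overFq : ∀ t → All IsFq (monomial t)
    monomial-overFq zero    = pow-1# q ∷ []
    monomial-overFq (suc t) = pow-≈0 q refl q>0 ∷ monomial-overFq t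

    -- θ is transcendental over F_q and X^n - X has coefficients 0, -1 and 1 in F_q.
    θ^n-θ≉0 : ∀ n → 1 < n → ¬ pow θ n - θ ≈ 0#
    θ^n-θ≉0 (suc zero) (s≤s ())
    θ^n-θ≉0 (suc (suc t)) _ θ^n-θ≈0 = θ-transc (0# ∷ - 1# ∷ monomial t)
      (pow-≈0 q refl q>0 ∷ -1^q≈-1 ∷ monomial-overFq t) (there (here -1≉0)) (begin
        0# + θ * (- 1# + θ * evalP (monomial t) θ)  ≈⟨ +-identityˡ _ ⟩
        θ * (- 1# + θ * evalP (monomial t) θ)       ≈⟨ *-congˡ (+-congˡ (*-congˡ (evalP-monomial t θ))) ⟩
        θ * (- 1# + pow θ (suc t))                  ≈⟨ distribˡ θ (- 1#) _ ⟩
        θ * - 1# + pow θ (suc (suc t))              ≈⟨ +-congʳ (trans (*-comm θ (- 1#)) (-1*x≈-x θ)) ⟩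
        - θ + pow θ (suc (suc t))                   ≈⟨ +-comm _ _ ⟩
        pow θ (suc (suc t)) - θ                     ≈⟨ θ^n-θ≈0 ⟩
        0#                                          ∎)

    br≉0 : ∀ k → ¬ br (suc k) ≈ 0#
    br≉0 k = θ^n-θ≉0 (q ^ suc k) (ℕ.^-monoʳ-< q 1<q {0} {suc k} ℕ.z<s)

  module ClosedForm (q>0 : 0 < q) (-1^q≈-1 : pow (- 1#) q ≈ - 1#) (br≉0 : ∀ k → ¬ br (suc k) ≈ 0#)
                    {r₀ : ℕ} (s : Fin (suc r₀) → ℕ) (u : Fin (suc r₀) → Carrier) (s≥1 : ∀ m → 1 ≤ s m) where
    open TModule s u
    open TModuleLemmas F q θ q>0 s u

    pow-neg : ∀ x n → pow (- x) (q ^ n) ≈ - pow x (q ^ n)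
    pow-neg x n = begin
      pow (- x) (q ^ n)                   ≈⟨ pow-cong (q ^ n) (-1*x≈-x x) ⟨
      pow (- 1# * x) (q ^ n)              ≈⟨ pow-distrib-* (- 1#) x (q ^ n) ⟩
      pow (- 1#) (q ^ n) * pow x (q ^ n)  ≈⟨ *-congʳ (-1^m≈-1⇒-1^[m^n]≈-1 -1^q≈-1 n) ⟩
      - 1# * pow x (q ^ n)                ≈⟨ -1*x≈-x _ ⟩
      - pow x (q ^ n)                     ∎

    br-zero : br 0 ≈ 0#
    br-zero = trans (+-congʳ (*-identityʳ θ)) (-‿inverseʳ θ)

    L-suc : ∀ k → L (suc k) ≈ - br (suc k) * L k
    L-suc k = trans (interchange (- 1#) (pow (- 1#) k) (br (suc k)) (brProd k)) (*-congʳ (-1*x≈-x _))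

    L≉0 : ∀ k → ¬ L k ≈ 0#
    L≉0 k = *-≉0 (pow-≉0 k -1≉0) (brProd≉0 k)
      where
      brProd≉0 : ∀ k → ¬ brProd k ≈ 0#
      brProd≉0 zero    1≈0 = 0≉1 (sym 1≈0)
      brProd≉0 (suc k)     = *-≉0 (br≉0 k) (brProd≉0 k)

    L⁻¹-zero : L 0 ⁻¹ ≈ 1#
    L⁻¹-zero = *-cancelˡ (L≉0 0) (trans (inverseʳ _ (L≉0 0)) (sym (trans (*-identityʳ _) (*-identityʳ 1#))))

    L⁻¹-suc : ∀ k → - br (suc k) * L (suc k) ⁻¹ ≈ L k ⁻¹
    L⁻¹-suc k = *-cancelˡ (L≉0 k) (begin
      L k * (- br (suc k) * L (suc k) ⁻¹)  ≈⟨ *-assoc _ _ _ ⟨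
      (L k * - br (suc k)) * L (suc k) ⁻¹  ≈⟨ *-congʳ (trans (*-comm _ _) (sym (L-suc k))) ⟩
      L (suc k) * L (suc k) ⁻¹             ≈⟨ inverseʳ _ (L≉0 (suc k)) ⟩
      1#                                   ≈⟨ inverseʳ _ (L≉0 k) ⟨
      L k * L k ⁻¹                         ∎)

    sizesFrom : ℕ → Fin (suc r₀) → ℕ
    sizesFrom t i = if ⌊ t ℕ.≤? toℕ i ⌋ then s i else 0

    dd-split : ∀ m → dd m ≡ s m ℕ.+ ∑ℕFin (sizesFrom (suc (toℕ m)))
    dd-split m = ≡.trans (∑ℕFin≡sum (sizesFrom (toℕ m)))
      (≡.trans (sum-isolate ℕ.+-0-commutativeMonoid m later-blocks not-after-itself)
               (≡.cong₂ ℕ._+_ counts-itself (≡.sym (∑ℕFin≡sum (sizesFrom (suc (toℕ m)))))))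
      where
      later-blocks : ∀ i → i ≢ m → sizesFrom (toℕ m) i ≡ sizesFrom (suc (toℕ m)) i
      later-blocks i i≢m with toℕ m ℕ.≤? toℕ i | suc (toℕ m) ℕ.≤? toℕ i
      ... | yes _   | yes _   = ≡.refl
      ... | no _    | no _    = ≡.refl
      ... | yes m≤i | no m≮i  = ⊥-elim (m≮i (ℕ.≤∧≢⇒< m≤i (i≢m ∘ Fin.toℕ-injective ∘ ≡.sym)))
      ... | no m≰i  | yes m<i = ⊥-elim (m≰i (ℕ.<⇒≤ m<i))
      not-after-itself : sizesFrom (suc (toℕ m)) m ≡ 0
      not-after-itself with suc (toℕ m) ℕ.≤? toℕ m
      ... | yes m<m = ⊥-elim (ℕ.<-irrefl ≡.refl m<m)
      ... | no _    = ≡.refl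
      counts-itself : sizesFrom (toℕ m) m ≡ s m
      counts-itself with toℕ m ℕ.≤? toℕ m
      ... | yes _   = ≡.refl
      ... | no m≰m  = ⊥-elim (m≰m ℕ.≤-refl)

    dd-pred : ∀ {m m⁻} → toℕ m ≡ suc (toℕ m⁻) → dd m⁻ ≡ s m⁻ ℕ.+ dd m
    dd-pred {m} {m⁻} m≡1+m⁻ =
      ≡.trans (dd-split m⁻) (≡.cong (λ t → s m⁻ ℕ.+ ∑ℕFin (sizesFrom t)) (≡.sym m≡1+m⁻))

    dd≡1+[dd∸1] : ∀ m → dd m ≡ suc (dd m ∸ 1)
    dd≡1+[dd∸1] m =
      ℕ.+-∸-assoc 1 (ℕ.≤-trans (s≥1 m) (≡.subst (s m ≤_) (≡.sym (dd-split m)) (ℕ.m≤m+n (s m) _)))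

    last : ∀ m → Fin (dd m)
    last m = Fin.fromℕ< (≡.subst (dd m ∸ 1 <_) (≡.sym (dd≡1+[dd∸1] m)) ℕ.≤-refl)

    last-is-last : ∀ m → suc (toℕ (last m)) ≡ dd m
    last-is-last m = ≡.trans (≡.cong suc (Fin.toℕ-fromℕ< _)) (≡.sym (dd≡1+[dd∸1] m))

    Ecoef-diag : ∀ m → Ecoef m m ≈ 1#
    Ecoef-diag m =
      trans (*-cong (reflexive (≡.cong (pow (- 1#)) (ℕ.n∸n≡0 (toℕ m)))) (∏Fin-one empty-range)) (*-identityˡ 1#)
      where
      empty-range : ∀ e → (if ⌊ toℕ m ℕ.≤? toℕ e ⌋ ∧ ⌊ toℕ e ℕ.<? toℕ m ⌋ then u e else 1#) ≈ 1#
      empty-range e with toℕ m ℕ.≤? toℕ e | toℕ e ℕ.<? toℕ m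
      ... | yes m≤e | yes e<m = ⊥-elim (ℕ.<⇒≱ e<m m≤e)
      ... | yes _   | no _    = refl
      ... | no _    | _       = refl

    Ecoef-pred : ∀ {ℓ m m⁻} → toℕ m ≡ suc (toℕ m⁻) → toℕ ℓ ≤ toℕ m⁻ →
                 Ecoef ℓ m ≈ - u m⁻ * Ecoef ℓ m⁻
    Ecoef-pred {ℓ} {m} {m⁻} m≡1+m⁻ ℓ≤m⁻ = begin
      pow (- 1#) (toℕ m ∸ toℕ ℓ) * ∏Fin range
        ≈⟨ *-cong (reflexive (≡.cong (pow (- 1#))
                    (≡.trans (≡.cong (_∸ toℕ ℓ) m≡1+m⁻) (ℕ.+-∸-assoc 1 ℓ≤m⁻))))
                  (∏Fin-isolate m⁻ range≈range⁻ range⁻-at-m⁻) ⟩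
      (- 1# * pow (- 1#) (toℕ m⁻ ∸ toℕ ℓ)) * (range m⁻ * ∏Fin range⁻)
        ≈⟨ interchange _ _ _ _ ⟩
      (- 1# * range m⁻) * Ecoef ℓ m⁻
        ≈⟨ *-congʳ (trans (-1*x≈-x _) (-‿cong range-at-m⁻)) ⟩
      - u m⁻ * Ecoef ℓ m⁻
        ∎
      where
      range range⁻ : Fin (suc r₀) → Carrier
      range e  = if ⌊ toℕ ℓ ℕ.≤? toℕ e ⌋ ∧ ⌊ toℕ e ℕ.<? toℕ m ⌋ then u e else 1#
      range⁻ e = if ⌊ toℕ ℓ ℕ.≤? toℕ e ⌋ ∧ ⌊ toℕ e ℕ.<? toℕ m⁻ ⌋ then u e else 1#
      range≈range⁻ : ∀ e → e ≢ m⁻ → range e ≈ range⁻ e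
      range≈range⁻ e e≢m⁻ with toℕ ℓ ℕ.≤? toℕ e | toℕ e ℕ.<? toℕ m | toℕ e ℕ.<? toℕ m⁻
      ... | no _  | _       | _       = refl
      ... | yes _ | yes _   | yes _   = refl
      ... | yes _ | no _    | no _    = refl
      ... | yes _ | yes e<m | no e≮m⁻ =
        ⊥-elim (e≮m⁻ (ℕ.≤∧≢⇒< (ℕ.s≤s⁻¹ (≡.subst (toℕ e <_) m≡1+m⁻ e<m)) (e≢m⁻ ∘ Fin.toℕ-injective)))
      ... | yes _ | no e≮m  | yes e<m⁻ =
        ⊥-elim (e≮m (≡.subst (toℕ e <_) (≡.sym m≡1+m⁻) (ℕ.m<n⇒m<1+n e<m⁻)))
      range⁻-at-m⁻ : range⁻ m⁻ ≈ 1#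
      range⁻-at-m⁻ with toℕ ℓ ℕ.≤? toℕ m⁻ | toℕ m⁻ ℕ.<? toℕ m⁻
      ... | no _  | _         = refl
      ... | yes _ | no _      = refl
      ... | yes _ | yes m⁻<m⁻ = ⊥-elim (ℕ.<-irrefl ≡.refl m⁻<m⁻)
      range-at-m⁻ : range m⁻ ≈ u m⁻
      range-at-m⁻ with toℕ ℓ ℕ.≤? toℕ m⁻ | toℕ m⁻ ℕ.<? toℕ m
      ... | yes _  | yes _   = refl
      ... | no ℓ≰m⁻ | _      = ⊥-elim (ℓ≰m⁻ ℓ≤m⁻)
      ... | yes _  | no m⁻≮m = ⊥-elim (m⁻≮m (ℕ.≤-reflexive (≡.sym m≡1+m⁻)))

    Ecorner-diag : ∀ m → Ecorner m m ≈ 1#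
    Ecorner-diag m with toℕ m ℕ.≤? toℕ m
    ... | yes _   = Ecoef-diag m
    ... | no m≰m  = ⊥-elim (m≰m ℕ.≤-refl)

    Ecorner-lower : ∀ {ℓ m} → toℕ m < toℕ ℓ → Ecorner ℓ m ≡ 0#
    Ecorner-lower {ℓ} {m} m<ℓ with toℕ ℓ ℕ.≤? toℕ m
    ... | yes ℓ≤m = ⊥-elim (ℕ.<⇒≱ m<ℓ ℓ≤m)
    ... | no _    = ≡.refl

    Ecorner-pred : ∀ {ℓ m m⁻} → toℕ m ≡ suc (toℕ m⁻) → toℕ ℓ ≤ toℕ m⁻ →
                   Ecorner ℓ m ≈ - u m⁻ * Ecorner ℓ m⁻
    Ecorner-pred {ℓ} {m} {m⁻} m≡1+m⁻ ℓ≤m⁻ with toℕ ℓ ℕ.≤? toℕ m | toℕ ℓ ℕ.≤? toℕ m⁻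
    ... | yes _   | yes _    = Ecoef-pred m≡1+m⁻ ℓ≤m⁻
    ... | _       | no ℓ≰m⁻  = ⊥-elim (ℓ≰m⁻ ℓ≤m⁻)
    ... | no ℓ≰m  | yes _    =
      ⊥-elim (ℓ≰m (ℕ.≤-trans ℓ≤m⁻ (≡.subst (toℕ m⁻ ≤_) (≡.sym m≡1+m⁻) (ℕ.n≤1+n _))))

    frobEcorner-pred : ∀ k {ℓ m m⁻} → toℕ m ≡ suc (toℕ m⁻) → ℓ ≢ m →
                       pow (Ecorner ℓ m) (q ^ k) ≈ - pow (u m⁻) (q ^ k) * pow (Ecorner ℓ m⁻) (q ^ k)
    frobEcorner-pred k {ℓ} {m} {m⁻} m≡1+m⁻ ℓ≢m with ℕ.≤-<-connex (toℕ ℓ) (toℕ m⁻)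
    ... | inj₁ ℓ≤m⁻ = begin
      pow (Ecorner ℓ m) (q ^ k)                          ≈⟨ pow-cong (q ^ k) (Ecorner-pred m≡1+m⁻ ℓ≤m⁻) ⟩
      pow (- u m⁻ * Ecorner ℓ m⁻) (q ^ k)                ≈⟨ pow-distrib-* _ _ (q ^ k) ⟩
      pow (- u m⁻) (q ^ k) * pow (Ecorner ℓ m⁻) (q ^ k)  ≈⟨ *-congʳ (pow-neg (u m⁻) k) ⟩
      - pow (u m⁻) (q ^ k) * pow (Ecorner ℓ m⁻) (q ^ k)  ∎
    ... | inj₂ m⁻<ℓ = trans (pow-≈0 (q ^ k) (reflexive (Ecorner-lower m<ℓ)) (q^n>0 k))
                           (sym (trans (*-congˡ (pow-≈0 (q ^ k) (reflexive (Ecorner-lower m⁻<ℓ)) (q^n>0 k))) (zeroʳ _)))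
      where
      m<ℓ : toℕ m < toℕ ℓ
      m<ℓ = ℕ.≤∧≢⇒< (≡.subst (_≤ toℕ ℓ) (≡.sym m≡1+m⁻) m⁻<ℓ) (ℓ≢m ∘ Fin.toℕ-injective ∘ ≡.sym)

    weight : Fin (suc r₀) → ℕ → Carrier
    weight m k = pow (u m) (q ^ k) * pow (L k ⁻¹) (s m)

    -- The sum over 0 ≤ i₁ ≤ ⋯ ≤ i_m < i in the entries of block m (blocks are numbered from 0).
    chain : Fin (suc r₀) → ℕ → Carrier
    chain m = chainSum (toℕ m) (λ e → weight (inject e))

    weight-cong : ∀ {m m'} → toℕ m ≡ toℕ m' → ∀ k → weight m k ≈ weight m' k
    weight-cong m≡m' k = reflexive (≡.cong (λ m → weight m k) (Fin.toℕ-injective m≡m'))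

    chain-suc : ∀ (m : Fin r₀) k →
                chain (Fin.suc m) (suc k) ≈ chain (Fin.suc m) k + chain (inject₁ m) (suc k) * weight (inject₁ m) k
    chain-suc m k = +-congˡ (*-cong
      (chainSum-cong (≡.sym (Fin.toℕ-inject₁ m)) (λ e e' e≡e' → weight-cong (inject-inject₁ e≡e')) (suc k))
      (weight-cong (≡.trans (Fin.toℕ-inject (fromℕ (toℕ m)))
                            (≡.trans (Fin.toℕ-fromℕ (toℕ m)) (≡.sym (Fin.toℕ-inject₁ m)))) k))
      where
      inject-inject₁ : ∀ {e : Fin (toℕ m)} {e' : Fin (toℕ (inject₁ m))} → toℕ e ≡ toℕ e' →
                       toℕ (inject {i = Fin.suc m} (inject₁ e)) ≡ toℕ (inject {i = inject₁ m} e')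
      inject-inject₁ {e} {e'} e≡e' = ≡.trans (Fin.toℕ-inject (inject₁ e))
        (≡.trans (Fin.toℕ-inject₁ e) (≡.trans e≡e' (≡.sym (Fin.toℕ-inject e'))))

    lastEntry : ℕ → Fin (suc r₀) → Carrier
    lastEntry k ℓ = pow (- 1#) (toℕ ℓ) * (chain ℓ k * pow (L k ⁻¹) (dd ℓ))

    Ecolumn : ℕ → Fin (suc r₀) → Carrier
    Ecolumn k m = pow (- 1#) (toℕ m) * (chain m (suc k) * pow (L k ⁻¹) (dd m))

    Ecolumn-pred : ∀ k (m : Fin r₀) →
                   lastEntry k (Fin.suc m) + - pow (u (inject₁ m)) (q ^ k) * Ecolumn k (inject₁ m) ≈ Ecolumn k (Fin.suc m)
    Ecolumn-pred k m = begin
      lastEntry k (Fin.suc m) + - U * Ecolumn k m⁻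
        ≈⟨ +-cong (*-congʳ sign) (*-congˡ (*-congˡ (*-congˡ Λ-split))) ⟩
      - A * (C₁ * Λd) + - U * (A * (C₀ * (Λs * Λd)))
        ≈⟨ +-congˡ move-U ⟩
      - A * (C₁ * Λd) + - A * ((C₀ * (U * Λs)) * Λd)
        ≈⟨ distribˡ (- A) _ _ ⟨
      - A * (C₁ * Λd + (C₀ * (U * Λs)) * Λd)
        ≈⟨ *-congˡ (distribʳ Λd C₁ _) ⟨
      - A * ((C₁ + C₀ * (U * Λs)) * Λd)
        ≈⟨ *-cong (sym sign) (*-congʳ (sym (chain-suc m k))) ⟩
      Ecolumn k (Fin.suc m)
        ∎
      where
      m⁻ : Fin (suc r₀)
      m⁻ = inject₁ m
      U A C₀ C₁ Λs Λd : Carrier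
      U = pow (u m⁻) (q ^ k)
      A = pow (- 1#) (toℕ m⁻)
      C₀ = chain m⁻ (suc k)
      C₁ = chain (Fin.suc m) k
      Λs = pow (L k ⁻¹) (s m⁻)
      Λd = pow (L k ⁻¹) (dd (Fin.suc m))
      sign : pow (- 1#) (toℕ (Fin.suc m)) ≈ - A
      sign = trans (*-congˡ (reflexive (≡.cong (pow (- 1#)) (≡.sym (Fin.toℕ-inject₁ m))))) (-1*x≈-x A)
      Λ-split : pow (L k ⁻¹) (dd m⁻) ≈ Λs * Λd
      Λ-split = trans (reflexive (≡.cong (pow (L k ⁻¹)) (dd-pred (≡.cong suc (≡.sym (Fin.toℕ-inject₁ m))))))
                      (pow-homo-+ (L k ⁻¹) (s m⁻) (dd (Fin.suc m)))
      move-U : - U * (A * (C₀ * (Λs * Λd))) ≈ - A * ((C₀ * (U * Λs)) * Λd)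
      move-U = trans (sym (-‿distribˡ-* _ _)) (trans (-‿cong (solve 5
        (λ U A C Λs Λd → U ⊕ (A ⊕ (C ⊕ (Λs ⊕ Λd))) ⊜ A ⊕ ((C ⊕ (U ⊕ Λs)) ⊕ Λd)) refl U A C₀ Λs Λd))
        (-‿distribˡ-* _ _))
        where open CommutativeMonoidSolver *-commutativeMonoid using (solve; _⊜_; _⊕_)

    -- Induction on m: the sums for consecutive blocks differ by the factor -u^(q^k) and the diagonal
    -- term, exactly as chain-suc relates the chain sums.
    ∑lastEntry*Ecorner : ∀ k m → ∑Fin (λ ℓ → lastEntry k ℓ * pow (Ecorner ℓ m) (q ^ k)) ≈ Ecolumn k m
    ∑lastEntry*Ecorner k = <-weakInduction (λ m → ∑Fin (term m) ≈ Ecolumn k m) first-block next-block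
      where
      term : Fin (suc r₀) → Fin (suc r₀) → Carrier
      term m ℓ = lastEntry k ℓ * pow (Ecorner ℓ m) (q ^ k)
      term-diag : ∀ m → term m m ≈ lastEntry k m
      term-diag m = trans (*-congˡ (trans (pow-cong (q ^ k) (Ecorner-diag m)) (pow-1# (q ^ k)))) (*-identityʳ _)
      term-lower : ∀ {ℓ m} → toℕ m < toℕ ℓ → term m ℓ ≈ 0#
      term-lower m<ℓ = trans (*-congˡ (pow-≈0 (q ^ k) (reflexive (Ecorner-lower m<ℓ)) (q^n>0 k))) (zeroʳ _)
      first-block : ∑Fin (term Fin.zero) ≈ Ecolumn k Fin.zero
      first-block =
        trans (∑Fin-single Fin.zero (λ ℓ ℓ≢0 → term-lower (ℕ.n≢0⇒n>0 (ℓ≢0 ∘ Fin.toℕ-injective)))) (term-diag Fin.zero)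
      next-block : ∀ m → ∑Fin (term (inject₁ m)) ≈ Ecolumn k (inject₁ m) →
                   ∑Fin (term (Fin.suc m)) ≈ Ecolumn k (Fin.suc m)
      next-block m IH = begin
        ∑Fin (term (Fin.suc m))
          ≈⟨ ∑Fin-isolate (Fin.suc m) off-diagonal on-diagonal ⟩
        term (Fin.suc m) (Fin.suc m) + ∑Fin (λ ℓ → μ * term m⁻ ℓ)
          ≈⟨ +-cong (term-diag (Fin.suc m)) (trans (∑Fin-*ˡ μ (term m⁻)) (*-congˡ IH)) ⟩
        lastEntry k (Fin.suc m) + μ * Ecolumn k m⁻
          ≈⟨ Ecolumn-pred k m ⟩
        Ecolumn k (Fin.suc m)
          ∎
        where
        m⁻ : Fin (suc r₀)
        m⁻ = inject₁ m
        μ : Carrier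
        μ = - pow (u m⁻) (q ^ k)
        m≡1+m⁻ : toℕ (Fin.suc m) ≡ suc (toℕ m⁻)
        m≡1+m⁻ = ≡.cong suc (≡.sym (Fin.toℕ-inject₁ m))
        off-diagonal : ∀ ℓ → ℓ ≢ Fin.suc m → term (Fin.suc m) ℓ ≈ μ * term m⁻ ℓ
        off-diagonal ℓ ℓ≢m = trans (*-congˡ (frobEcorner-pred k m≡1+m⁻ ℓ≢m)) (x∙yz≈y∙xz _ _ _)
        on-diagonal : μ * term m⁻ (Fin.suc m) ≈ 0#
        on-diagonal = trans (*-congˡ (term-lower (ℕ.≤-reflexive (≡.sym m≡1+m⁻)))) (zeroʳ _)

    target : ℕ → Fin (suc r₀) → ℕ → Carrier
    target i m j = pow (- 1#) (toℕ m) * pow (- br i) (dd m ∸ suc j) * (chain m i * pow (L i ⁻¹) (dd m))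

    target-last : ∀ k ℓ j → suc j ≡ dd ℓ → target k ℓ j ≈ lastEntry k ℓ
    target-last k ℓ j j-last =
      *-congʳ (trans (*-congˡ (reflexive (≡.cong (pow (- br k)) exponent-zero))) (*-identityʳ _))
      where
      exponent-zero : dd ℓ ∸ suc j ≡ 0
      exponent-zero = ≡.trans (≡.cong (dd ℓ ∸_) j-last) (ℕ.n∸n≡0 (dd ℓ))

    br*target-shift : ∀ k m j → suc (suc j) ≤ dd m → br (suc k) * target (suc k) m (suc j) ≈ - target (suc k) m j
    br*target-shift k m j j+2≤d = begin
      b * (A * B * Z)
        ≈⟨ x*y≈-[-x*y] b _ ⟩
      - (- b * (A * B * Z))
        ≈⟨ -‿cong (solve 4 (λ b A B Z → b ⊕ ((A ⊕ B) ⊕ Z) ⊜ (A ⊕ (b ⊕ B)) ⊕ Z) refl (- b) A B Z) ⟩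
      - (A * (- b * B) * Z)
        ≈⟨ -‿cong (*-congʳ (*-congˡ (reflexive (≡.cong (pow (- b)) (≡.sym (ℕ.+-∸-assoc 1 j+2≤d)))))) ⟩
      - target (suc k) m j
        ∎
      where
      open CommutativeMonoidSolver *-commutativeMonoid using (solve; _⊜_; _⊕_)
      b A B Z : Carrier
      b = br (suc k)
      A = pow (- 1#) (toℕ m)
      B = pow (- b) (dd m ∸ suc (suc j))
      Z = chain m (suc k) * pow (L (suc k) ⁻¹) (dd m)

    br*target-firstCol : ∀ k m → br (suc k) * target (suc k) m 0 ≈ - Ecolumn k m
    br*target-firstCol k m = begin
      b * (A * B * (C * Λ))
        ≈⟨ x*y≈-[-x*y] b _ ⟩
      - (- b * (A * B * (C * Λ)))
        ≈⟨ -‿cong (solve 5 (λ b A B C Λ → b ⊕ ((A ⊕ B) ⊕ (C ⊕ Λ)) ⊜ A ⊕ (C ⊕ ((b ⊕ B) ⊕ Λ)))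
                         refl (- b) A B C Λ) ⟩
      - (A * (C * (- b * B * Λ)))
        ≈⟨ -‿cong (*-congˡ (*-congˡ (*-congʳ (reflexive (≡.cong (pow (- b)) (≡.sym (dd≡1+[dd∸1] m))))))) ⟩
      - (A * (C * (pow (- b) d * Λ)))
        ≈⟨ -‿cong (*-congˡ (*-congˡ (sym (pow-distrib-* (- b) _ d)))) ⟩
      - (A * (C * pow (- b * L (suc k) ⁻¹) d))
        ≈⟨ -‿cong (*-congˡ (*-congˡ (pow-cong d (L⁻¹-suc k)))) ⟩
      - Ecolumn k m
        ∎
      where
      open CommutativeMonoidSolver *-commutativeMonoid using (solve; _⊜_; _⊕_)
      d : ℕ
      d = dd m
      b A B C Λ : Carrier
      b = br (suc k)
      A = pow (- 1#) (toℕ m)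
      B = pow (- b) (d ∸ 1)
      C = chain m (suc k)
      Λ = pow (L (suc k) ⁻¹) d

    ·M-frobM-EM-firstCol : ∀ A k x {m} (c : Fin (dd m)) → toℕ c ≡ 0 →
                           (A ·M frobM k EM) x (m , c) ≈ ∑Fin (λ ℓ → A x (ℓ , last ℓ) * pow (Ecorner ℓ m) (q ^ k))
    ·M-frobM-EM-firstCol A k x {m} c c≡0 = trans
      (∑Idx-lastRows {f = λ z → A x z * frobM k EM z (m , c)} last last-is-last (λ ℓ b b≢last →
        trans (*-congˡ (pow-≈0 (q ^ k) (reflexive (EM-notLastRow {ℓ} b (m , c) b≢last)) (q^n>0 k))) (zeroʳ _)))
      (∑Fin-cong {f = λ ℓ → A x (ℓ , last ℓ) * frobM k EM (ℓ , last ℓ) (m , c)} (λ ℓ →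
        *-congˡ (reflexive (≡.cong (λ e → pow e (q ^ k)) (EM-corner (last ℓ) c (last-is-last ℓ) c≡0)))))

    module LastRowOfFirstBlock (P : Series) (isLog : IsLog P)
                               (a : Fin (dd Fin.zero)) (a-last : suc (toℕ a) ≡ dd Fin.zero) where

      x₀ : Idx
      x₀ = (Fin.zero , a)

      identity≈target : ∀ m (j : Fin (dd m)) → IdM x₀ (m , j) ≈ target 0 m (toℕ j)
      identity≈target (Fin.suc m) j =
        trans (reflexive (IdM-offBlock {Fin.zero} a j λ ())) (sym (trans (*-congˡ (zeroˡ _)) (zeroʳ _)))
      identity≈target Fin.zero j with j Fin.≟ a
      ... | yes ≡.refl = trans (IdM-diag x₀)
        (sym (trans (*-cong (*-congˡ exponent-zero) Λ≈1) (trans (*-identityʳ _) (*-identityˡ 1#))))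
        where
        exponent-zero : pow (- br 0) (dd Fin.zero ∸ suc (toℕ a)) ≈ 1#
        exponent-zero = reflexive (≡.cong (pow (- br 0))
          (≡.trans (≡.cong (_∸ suc (toℕ a)) (≡.sym a-last)) (ℕ.n∸n≡0 (toℕ a))))
        Λ≈1 : 1# * pow (L 0 ⁻¹) (dd Fin.zero) ≈ 1#
        Λ≈1 = trans (*-identityˡ _) (trans (pow-cong (dd Fin.zero) L⁻¹-zero) (pow-1# (dd Fin.zero)))
      ... | no j≢a = trans (reflexive (IdM-offDiag {Fin.zero} a j (j≢a ∘ ≡.sym)))
        (sym (trans (*-congʳ (trans (*-congˡ (pow-≈0 _ (trans (-‿cong br-zero) -0#≈0#) exponent>0)) (zeroʳ _)))
                    (zeroˡ _)))
        where
        exponent>0 : 0 < dd Fin.zero ∸ suc (toℕ j)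
        exponent>0 = ℕ.m<n⇒0<n∸m (≡.subst (suc (toℕ j) <_) a-last (ℕ.s≤s (ℕ.≤∧≢⇒< j≤a (j≢a ∘ Fin.toℕ-injective))))
          where
          j≤a : toℕ j ≤ toℕ a
          j≤a = ℕ.s≤s⁻¹ (≡.subst (toℕ j <_) (≡.sym a-last) (Fin.toℕ<n j))

      recursion : ∀ k y → br (suc k) * P (suc k) x₀ y ≈ - ((P k ·M frobM k EM) x₀ y + (P (suc k) ·M NM) x₀ y)
      recursion = log-lastRow-recursion {P} (proj₂ isLog) {Fin.zero} a a-last

      next-degree : ∀ k → (∀ m (j : Fin (dd m)) → P k x₀ (m , j) ≈ target k m (toℕ j)) →
                    ∀ m n (j : Fin (dd m)) → toℕ j ≡ n → P (suc k) x₀ (m , j) ≈ target (suc k) m n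
      next-degree k IH m zero j j≡0 = *-cancelˡ (br≉0 k) (begin
        br (suc k) * P (suc k) x₀ (m , j)
          ≈⟨ recursion k (m , j) ⟩
        - ((P k ·M frobM k EM) x₀ (m , j) + (P (suc k) ·M NM) x₀ (m , j))
          ≈⟨ -‿cong (+-cong E-part (·M-NM-firstCol (P (suc k)) x₀ j j≡0)) ⟩
        - (Ecolumn k m + 0#)
          ≈⟨ -‿cong (+-identityʳ _) ⟩
        - Ecolumn k m
          ≈⟨ br*target-firstCol k m ⟨
        br (suc k) * target (suc k) m 0
          ∎)
        where
        E-part : (P k ·M frobM k EM) x₀ (m , j) ≈ Ecolumn k m
        E-part = begin
          (P k ·M frobM k EM) x₀ (m , j)
            ≈⟨ ·M-frobM-EM-firstCol (P k) k x₀ j j≡0 ⟩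
          ∑Fin (λ ℓ → P k x₀ (ℓ , last ℓ) * pow (Ecorner ℓ m) (q ^ k))
            ≈⟨ ∑Fin-cong {f = λ ℓ → P k x₀ (ℓ , last ℓ) * pow (Ecorner ℓ m) (q ^ k)}
                         (λ ℓ → *-congʳ (trans (IH ℓ (last ℓ)) (target-last k ℓ _ (last-is-last ℓ)))) ⟩
          ∑Fin (λ ℓ → lastEntry k ℓ * pow (Ecorner ℓ m) (q ^ k))
            ≈⟨ ∑lastEntry*Ecorner k m ⟩
          Ecolumn k m
            ∎
      next-degree k IH m (suc n) j j≡n+1 = *-cancelˡ (br≉0 k) (begin
        br (suc k) * P (suc k) x₀ (m , j)
          ≈⟨ recursion k (m , j) ⟩
        - ((P k ·M frobM k EM) x₀ (m , j) + (P (suc k) ·M NM) x₀ (m , j))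
          ≈⟨ -‿cong (+-cong E-part (·M-NM-shift (P (suc k)) x₀ j⁻ j j≡j⁻+1)) ⟩
        - (0# + P (suc k) x₀ (m , j⁻))
          ≈⟨ -‿cong (trans (+-identityˡ _) (next-degree k IH m n j⁻ (Fin.toℕ-fromℕ< n<d))) ⟩
        - target (suc k) m n
          ≈⟨ br*target-shift k m n n+2≤d ⟨
        br (suc k) * target (suc k) m (suc n)
          ∎)
        where
        n+2≤d : suc (suc n) ≤ dd m
        n+2≤d = ≡.subst (λ t → suc t ≤ dd m) j≡n+1 (Fin.toℕ<n j)
        n<d : n < dd m
        n<d = ℕ.<-trans (ℕ.n<1+n n) n+2≤d
        j⁻ : Fin (dd m)
        j⁻ = Fin.fromℕ< n<d
        j≡j⁻+1 : toℕ j ≡ suc (toℕ j⁻)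
        j≡j⁻+1 = ≡.trans j≡n+1 (≡.cong suc (≡.sym (Fin.toℕ-fromℕ< n<d)))
        E-part : (P k ·M frobM k EM) x₀ (m , j) ≈ 0#
        E-part = ·M-zeroʳ (P k) {frobM k EM} x₀ (m , j) (λ z →
          pow-≈0 (q ^ k) (reflexive (EM-notFirstCol z j (λ j≡0 → ℕ.0≢1+n (≡.trans (≡.sym j≡0) j≡n+1)))) (q^n>0 k))

      closedForm : ∀ i m (j : Fin (dd m)) → P i x₀ (m , j) ≈ target i m (toℕ j)
      closedForm zero    m j = trans (proj₁ isLog x₀ (m , j)) (identity≈target m j)
      closedForm (suc k) m j = next-degree k (closedForm k) m (toℕ j) j ≡.refl

proposition3p7 : ∀ {c ℓ : Level} (F : Field c ℓ) →
    let open Field F hiding (zero) in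
    let open Setup F in
    (p e q : ℕ) (θ : Carrier) →
    let open Ground q θ in
    IsAlgClosureOfFqθ p e →
    (r₀ : ℕ) (s : Fin (suc r₀) → ℕ) (u : Fin (suc r₀) → Carrier) →
    (∀ m → 1 ≤ s m) → (∀ m → ¬ (u m ≈ 0#)) →
    let open TModule s u in
    (P : Series) → IsLog P →
    (a : Fin (dd Fin.zero)) → suc (toℕ a) ≡ dd Fin.zero →
    (i : ℕ) →
    ((j : Fin (dd Fin.zero)) →
       P i (Fin.zero , a) (Fin.zero , j)
         ≈ pow (- br i) (dd Fin.zero ∸ suc (toℕ j)) * pow (L i ⁻¹) (dd Fin.zero))
    ×
    ((m : Fin (suc r₀)) → 1 ≤ toℕ m → (j : Fin (dd m)) →
       P i (Fin.zero , a) (m , j)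
         ≈ pow (- 1#) (toℕ m) * pow (- br i) (dd m ∸ suc (toℕ j))
           * (chainSum (toℕ m)
                (λ e' k → pow (u (inject e')) (q ^ k) * pow (L k ⁻¹) (s (inject e')))
                i
              * pow (L i ⁻¹) (dd m)))
proposition3p7 F p e q θ AC r₀ s u s≥1 _ P isLog a a-last i =
  (λ j → trans (closedForm i Fin.zero j) (*-cong (*-identityˡ _) (*-identityˡ _))) ,
  (λ m _ j → closedForm i m j)
  where
  open Field F hiding (zero)
  open GroundLemmas F q θ
  open AlgClosureFacts AC
  open ClosedForm q>0 -1^q≈-1 br≉0 s u s≥1
  open LastRowOfFirstBlock P isLog a a-last
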